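{- For any CCC operation $\omega = \mathrm{op}(x:T \mid_\emptyset t) : \mathrm{Cl}(\{T \to T'\})\to \mathrm{Cl}(\{\square_1:T_1 \to T_1',\dots,\square_n : T_n \to T_n'\})$ and morphisms $f_i = (x_i:T_i \mid_\emptyset t_i) : T_i \to T_i'$ ($i=1,\dots,n$) of $\mathrm{Cl}(\Sigma')$ for a signature $\Sigma'$, \[ \omega\cdot (f_1,\dots,f_n)= (x:T \mid_\emptyset t[(\lambda x_1:T_1.~t_1)/\square_1,\dots,(\lambda x_n:T_n.~t_n)/\square_n]). \]
   Context: Setting: simply typed lambda calculus with product and unit types over a set $\Lambda$ of base types; $\mathrm{Cl}(\Sigma)$ is the cartesian closed category freely generated by a signature $\Sigma$, whose objects are types and whose morphisms $T\to T'$ are classes $(x:T\mid_\emptyset t:T')$ of terms-in-context $x:T\vdash t:T'$ modulo $\alpha\beta\delta\eta$-equivalence. A CCC operation is a morphism of $\Lambda$-sorted CCCs (a strict cartesian closed functor that is the identity on the structure coming from the free CCC on no symbols) $\omega:\mathrm{Cl}(\{c:T\to T'\})\to\mathrm{Cl}(\{\square_1:T_1\to T_1',\dots,\square_n:T_n\to T_n'\})$ with $T',T_1',\dots,T_n'$ base types; such $\omega$ is uniquely determined by the image of $(x:T\mid_\emptyset c\,x)$, and if that image is $\tau$ we write $\mathrm{op}(\tau)$ for the CCC operation determined by $\tau$. For a $\Lambda$-sorted CCC ${\mathbf C}$ with associated model $M$ of the Lawvere theory of $\Lambda$-sorted CCCs, the action is $\omega\cdot(f_1,\dots,f_n):=M\omega(f_1,\dots,f_n)$,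 i.e. the image of $(x:T\mid c\,x)$ under $\omega$ followed by the cartesian closed functor sending each $\square_i$ to $f_i$. -}

module Defs where

open import Data.Nat using (ℕ)
open import Data.Fin using (Fin)

data Ty (Λ : Set) : Set where
  base : Λ → Ty Λ
  𝟙    : Ty Λ
  _⊗_  : Ty Λ → Ty Λ → Ty Λ
  _⇒_  : Ty Λ → Ty Λ → Ty Λ

infixr 7 _⊗_
infixr 6 _⇒_

record Signature (Λ : Set) : Set₁ where
  field
    Sym : Set
    dom : Sym → Ty Λ
    cod : Sym → Ty Λ
open Signature public

data Ctx (Λ : Set) : Set where
  ε   : Ctx Λ
  _▸_ : Ctx Λ → Ty Λ → Ctx Λ

infixl 5 _▸_

data Var {Λ : Set} : Ctx Λ → Ty Λ → Set where
  vz : ∀ {Γ A} → Var (Γ ▸ A) A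
  vs : ∀ {Γ A B} → Var Γ A → Var (Γ ▸ B) A

-- Terms-in-context over a signature; a symbol c is a term of type dom c ⇒ cod c
-- (so "c x" is  app (cst c) x).
data Tm {Λ : Set} (Σ : Signature Λ) (Γ : Ctx Λ) : Ty Λ → Set where
  var  : ∀ {A} → Var Γ A → Tm Σ Γ A
  cst  : (c : Sym Σ) → Tm Σ Γ (dom Σ c ⇒ cod Σ c)
  lam  : ∀ {A B} → Tm Σ (Γ ▸ A) B → Tm Σ Γ (A ⇒ B)
  app  : ∀ {A B} → Tm Σ Γ (A ⇒ B) → Tm Σ Γ A → Tm Σ Γ B
  unit : Tm Σ Γ 𝟙
  pair : ∀ {A B} → Tm Σ Γ A → Tm Σ Γ B → Tm Σ Γ (A ⊗ B)
  fst  : ∀ {A B} → Tm Σ Γ (A ⊗ B) → Tm Σ Γ A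
  snd  : ∀ {A B} → Tm Σ Γ (A ⊗ B) → Tm Σ Γ B

module _ {Λ : Set} {Σ : Signature Λ} where

  Ren : Ctx Λ → Ctx Λ → Set
  Ren Γ Δ = ∀ {A} → Var Γ A → Var Δ A

  liftR : ∀ {Γ Δ B} → Ren Γ Δ → Ren (Γ ▸ B) (Δ ▸ B)
  liftR ρ vz     = vz
  liftR ρ (vs x) = vs (ρ x)

  rename : ∀ {Γ Δ A} → Ren Γ Δ → Tm Σ Γ A → Tm Σ Δ A
  rename ρ (var x)    = var (ρ x)
  rename ρ (cst c)    = cst c
  rename ρ (lam t)    = lam (rename (liftR ρ) t)
  rename ρ (app t u)  = app (rename ρ t) (rename ρ u)
  rename ρ unit       = unit
  rename ρ (pair t u) = pair (rename ρ t) (rename ρ u)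
  rename ρ (fst t)    = fst (rename ρ t)
  rename ρ (snd t)    = snd (rename ρ t)

  wk : ∀ {Γ A B} → Tm Σ Γ A → Tm Σ (Γ ▸ B) A
  wk = rename vs

  Sub : Ctx Λ → Ctx Λ → Set
  Sub Γ Δ = ∀ {A} → Var Γ A → Tm Σ Δ A

  liftS : ∀ {Γ Δ B} → Sub Γ Δ → Sub (Γ ▸ B) (Δ ▸ B)
  liftS σ vz     = var vz
  liftS σ (vs x) = wk (σ x)

  subst : ∀ {Γ Δ A} → Sub Γ Δ → Tm Σ Γ A → Tm Σ Δ A
  subst σ (var x)    = σ x
  subst σ (cst c)    = cst c
  subst σ (lam t)    = lam (subst (liftS σ) t)
  subst σ (app t u)  = app (subst σ t) (subst σ u)
  subst σ unit       = unit
  subst σ (pair t u) = pair (subst σ t) (subst σ u)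
  subst σ (fst t)    = fst (subst σ t)
  subst σ (snd t)    = snd (subst σ t)

  sub0 : ∀ {Γ A} → Tm Σ Γ A → Sub (Γ ▸ A) Γ
  sub0 u vz     = u
  sub0 u (vs x) = var x

  _[_]₀ : ∀ {Γ A B} → Tm Σ (Γ ▸ A) B → Tm Σ Γ A → Tm Σ Γ B
  t [ u ]₀ = subst (sub0 u) t

  -- αβδη-equivalence (α is built in via de Bruijn indices;
  -- β/η for functions, products and unit)
  infix 4 _≈_
  data _≈_ {Γ : Ctx Λ} : ∀ {A} → Tm Σ Γ A → Tm Σ Γ A → Set where
    ≈refl  : ∀ {A} {t : Tm Σ Γ A} → t ≈ t
    ≈sym   : ∀ {A} {t u : Tm Σ Γ A} → t ≈ u → u ≈ t
    ≈trans : ∀ {A} {t u v : Tm Σ Γ A} → t ≈ u → u ≈ v → t ≈ v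
    lam-cong  : ∀ {A B} {t u : Tm Σ (Γ ▸ A) B} → t ≈ u → lam t ≈ lam u
    app-cong  : ∀ {A B} {t t' : Tm Σ Γ (A ⇒ B)} {u u'} → t ≈ t' → u ≈ u' → app t u ≈ app t' u'
    pair-cong : ∀ {A B} {t t' : Tm Σ Γ A} {u u' : Tm Σ Γ B} → t ≈ t' → u ≈ u' → pair t u ≈ pair t' u'
    fst-cong  : ∀ {A B} {t t' : Tm Σ Γ (A ⊗ B)} → t ≈ t' → fst t ≈ fst t'
    snd-cong  : ∀ {A B} {t t' : Tm Σ Γ (A ⊗ B)} → t ≈ t' → snd t ≈ snd t'
    ⇒β   : ∀ {A B} (t : Tm Σ (Γ ▸ A) B) (u : Tm Σ Γ A) → app (lam t) u ≈ t [ u ]₀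
    ⇒η   : ∀ {A B} (t : Tm Σ Γ (A ⇒ B)) → t ≈ lam (app (wk t) (var vz))
    ⊗β₁  : ∀ {A B} (t : Tm Σ Γ A) (u : Tm Σ Γ B) → fst (pair t u) ≈ t
    ⊗β₂  : ∀ {A B} (t : Tm Σ Γ A) (u : Tm Σ Γ B) → snd (pair t u) ≈ u
    ⊗η   : ∀ {A B} (t : Tm Σ Γ (A ⊗ B)) → t ≈ pair (fst t) (snd t)
    𝟙η   : (t : Tm Σ Γ 𝟙) → t ≈ unit

record CCCOps (Λ : Set) : Set₁ where
  field
    Hom   : Ty Λ → Ty Λ → Set
    idₕ   : ∀ {A} → Hom A A
    _∘ₕ_  : ∀ {A B C} → Hom B C → Hom A B → Hom A C
    !ₕ    : ∀ {A} → Hom A 𝟙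
    π₁ₕ   : ∀ {A B} → Hom (A ⊗ B) A
    π₂ₕ   : ∀ {A B} → Hom (A ⊗ B) B
    ⟨_,_⟩ₕ : ∀ {X A B} → Hom X A → Hom X B → Hom X (A ⊗ B)
    curryₕ : ∀ {A B C} → Hom (A ⊗ B) C → Hom A (B ⇒ C)
    evalₕ  : ∀ {B C} → Hom ((B ⇒ C) ⊗ B) C

-- The CCC structure of Cl(Σ): morphisms A → B are terms  x:A ⊢ t : B
-- (taken modulo _≈_).
Cl : {Λ : Set} → Signature Λ → CCCOps Λ
Cl {Λ} Σ = record
  { Hom    = λ A B → Tm Σ (ε ▸ A) B
  ; idₕ    = var vz
  ; _∘ₕ_   = λ g f → subst (one f) g
  ; !ₕ     = unit
  ; π₁ₕ    = fst (var vz)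
  ; π₂ₕ    = snd (var vz)
  ; ⟨_,_⟩ₕ = pair
  ; curryₕ = λ h → lam (subst (one (pair (var (vs vz)) (var vz))) h)
  ; evalₕ  = app (fst (var vz)) (snd (var vz))
  }
  where
  one : ∀ {Δ A} → Tm Σ Δ A → Sub {Σ = Σ} (ε ▸ A) Δ
  one f vz = f

-- The (unique) strict cartesian closed functor out of a free CCC Cl(Σ)
-- into a CCC 𝓒 (identity on types), determined by an assignment of each
-- symbol c : T → T' to a morphism T → T' of 𝓒.

module Interp {Λ : Set} {Σ : Signature Λ} (𝓒 : CCCOps Λ)
              (F : (c : Sym Σ) → CCCOps.Hom 𝓒 (dom Σ c) (cod Σ c)) where
  open CCCOps 𝓒

  Env : Ty Λ → Ctx Λ → Set
  Env X Γ = ∀ {A} → Var Γ A → Hom X A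

  extEnv : ∀ {X Γ A} → Env X Γ → Env (X ⊗ A) (Γ ▸ A)
  extEnv ρ vz     = π₂ₕ
  extEnv ρ (vs x) = ρ x ∘ₕ π₁ₕ

  ⟦_⟧ : ∀ {X Γ A} → Tm Σ Γ A → Env X Γ → Hom X A
  ⟦ var x ⟧    ρ = ρ x
  ⟦ cst c ⟧    ρ = curryₕ (F c ∘ₕ π₂ₕ)
  ⟦ lam t ⟧    ρ = curryₕ (⟦ t ⟧ (extEnv ρ))
  ⟦ app t u ⟧  ρ = evalₕ ∘ₕ ⟨ ⟦ t ⟧ ρ , ⟦ u ⟧ ρ ⟩ₕ
  ⟦ unit ⟧     ρ = !ₕ
  ⟦ pair t u ⟧ ρ = ⟨ ⟦ t ⟧ ρ , ⟦ u ⟧ ρ ⟩ₕ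
  ⟦ fst t ⟧    ρ = π₁ₕ ∘ₕ ⟦ t ⟧ ρ
  ⟦ snd t ⟧    ρ = π₂ₕ ∘ₕ ⟦ t ⟧ ρ

  functor : ∀ {A B} → Tm Σ (ε ▸ A) B → Hom A B
  functor t = ⟦ t ⟧ env
    where
    env : Env _ (ε ▸ _)
    env vz = idₕ

Boxes : {Λ : Set} (n : ℕ) → (Fin n → Ty Λ) → (Fin n → Λ) → Signature Λ
Boxes n Ts bs = record { Sym = Fin n ; dom = Ts ; cod = λ i → base (bs i) }

-- A CCC operation Cl({c : T → T'}) → Cl(Boxes n Ts bs) (T' base) is uniquely
-- determined by the image τ of (x:T | c x); op τ is the operation it determines.
record CCCOperation {Λ : Set} (n : ℕ) (Ts : Fin n → Ty Λ) (bs : Fin n → Λ)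
                    (T : Ty Λ) (T' : Λ) : Set where
  constructor op
  field
    image : Tm (Boxes n Ts bs) (ε ▸ T) (base T')

-- action  ω · (f₁,…,fₙ) := (image of (x:T | c x) under ω) followed by the
-- CCC functor Cl(Boxes) → Cl(Σ') sending □ᵢ to fᵢ
_·_ : {Λ : Set} {n : ℕ} {Ts : Fin n → Ty Λ} {bs : Fin n → Λ} {T : Ty Λ} {T' : Λ}
      {Σ' : Signature Λ} → CCCOperation n Ts bs T T' →
      ((i : Fin n) → Tm Σ' (ε ▸ Ts i) (base (bs i))) → Tm Σ' (ε ▸ T) (base T')
_·_ {Σ' = Σ'} ω fs = Interp.functor (Cl Σ') fs (CCCOperation.image ω)

-- replacing each symbol c of Σ by a closed term of Σ'  (t[u_c / c])
module _ {Λ : Set} {Σ Σ' : Signature Λ}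
         (u : (c : Sym Σ) → Tm Σ' ε (dom Σ c ⇒ cod Σ c)) where
  csubst : ∀ {Γ A} → Tm Σ Γ A → Tm Σ' Γ A
  csubst (var x)    = var x
  csubst (cst c)    = rename (λ ()) (u c)
  csubst (lam t)    = lam (csubst t)
  csubst (app t s)  = app (csubst t) (csubst s)
  csubst unit       = unit
  csubst (pair t s) = pair (csubst t) (csubst s)
  csubst (fst t)    = fst (csubst t)
  csubst (snd t)    = snd (csubst t)

{-# OPTIONS --safe #-}
-- In the syntactic CCC Cl(Σ') an environment for Γ over X is literally a
-- substitution from Γ into the context (x : X).  By induction on terms, the
-- interpretation of t in an environment ρ is ρ applied to t with each symbol c
-- replaced by the λ-abstraction of its image.  Constants and λ are both
-- interpreted as curryₕ of a term substituted by extEnv ρ (for a constant,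
-- F c ∘ₕ π₂ₕ is the weakened F c substituted that way); curryₕ pairs up the
-- two variables that extEnv projects out again, and the β-laws for products
-- reduce this to lifting ρ.  At the identity environment used by functor the
-- substitution vanishes.
module Submission where

open import Defs
open import Data.Nat using (ℕ)
open import Data.Fin using (Fin)
open import Relation.Binary.PropositionalEquality using (_≡_; refl; cong; cong₂; sym; trans)

module _ {Λ : Set} {Σ : Signature Λ} where

  private
    variable
      Γ Δ Θ : Ctx Λ
      A B : Ty Λ

  rename-cong : {ρ ρ' : Ren {Σ = Σ} Γ Δ} → (∀ {A} (x : Var Γ A) → ρ x ≡ ρ' x) →
                (t : Tm Σ Γ A) → rename ρ t ≡ rename ρ' t
  rename-cong h (var x)    = cong var (h x)
  rename-cong h (cst c)    = refl
  rename-cong h (lam t)    = cong lam (rename-cong (λ { vz → refl ; (vs x) → cong vs (h x) }) t)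
  rename-cong h (app t u)  = cong₂ app (rename-cong h t) (rename-cong h u)
  rename-cong h unit       = refl
  rename-cong h (pair t u) = cong₂ pair (rename-cong h t) (rename-cong h u)
  rename-cong h (fst t)    = cong fst (rename-cong h t)
  rename-cong h (snd t)    = cong snd (rename-cong h t)

  subst-cong : {σ σ' : Sub {Σ = Σ} Γ Δ} → (∀ {A} (x : Var Γ A) → σ x ≡ σ' x) →
               (t : Tm Σ Γ A) → subst σ t ≡ subst σ' t
  subst-cong h (var x)    = h x
  subst-cong h (cst c)    = refl
  subst-cong h (lam t)    = cong lam (subst-cong (λ { vz → refl ; (vs x) → cong wk (h x) }) t)
  subst-cong h (app t u)  = cong₂ app (subst-cong h t) (subst-cong h u)
  subst-cong h unit       = refl
  subst-cong h (pair t u) = cong₂ pair (subst-cong h t) (subst-cong h u)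
  subst-cong h (fst t)    = cong fst (subst-cong h t)
  subst-cong h (snd t)    = cong snd (subst-cong h t)

  rename-rename : (ρ : Ren {Σ = Σ} Γ Δ) (ρ' : Ren {Σ = Σ} Δ Θ) (t : Tm Σ Γ A) →
                  rename ρ' (rename ρ t) ≡ rename (λ x → ρ' (ρ x)) t
  rename-rename ρ ρ' (var x)    = refl
  rename-rename ρ ρ' (cst c)    = refl
  rename-rename ρ ρ' (lam t)    = cong lam (trans (rename-rename (liftR ρ) (liftR ρ') t)
                                                  (rename-cong (λ { vz → refl ; (vs x) → refl }) t))
  rename-rename ρ ρ' (app t u)  = cong₂ app (rename-rename ρ ρ' t) (rename-rename ρ ρ' u)
  rename-rename ρ ρ' unit       = refl
  rename-rename ρ ρ' (pair t u) = cong₂ pair (rename-rename ρ ρ' t) (rename-rename ρ ρ' u)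
  rename-rename ρ ρ' (fst t)    = cong fst (rename-rename ρ ρ' t)
  rename-rename ρ ρ' (snd t)    = cong snd (rename-rename ρ ρ' t)

  rename-wk : (ρ : Ren {Σ = Σ} Γ Δ) (t : Tm Σ Γ A) →
              rename (liftR {Σ = Σ} {B = B} ρ) (wk t) ≡ wk (rename ρ t)
  rename-wk ρ t = trans (rename-rename vs (liftR ρ) t) (sym (rename-rename ρ vs t))

  subst-rename : (ρ : Ren {Σ = Σ} Γ Δ) (σ : Sub {Σ = Σ} Δ Θ) (t : Tm Σ Γ A) →
                 subst σ (rename ρ t) ≡ subst (λ x → σ (ρ x)) t
  subst-rename ρ σ (var x)    = refl
  subst-rename ρ σ (cst c)    = refl
  subst-rename ρ σ (lam t)    = cong lam (trans (subst-rename (liftR ρ) (liftS σ) t)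
                                                (subst-cong (λ { vz → refl ; (vs x) → refl }) t))
  subst-rename ρ σ (app t u)  = cong₂ app (subst-rename ρ σ t) (subst-rename ρ σ u)
  subst-rename ρ σ unit       = refl
  subst-rename ρ σ (pair t u) = cong₂ pair (subst-rename ρ σ t) (subst-rename ρ σ u)
  subst-rename ρ σ (fst t)    = cong fst (subst-rename ρ σ t)
  subst-rename ρ σ (snd t)    = cong snd (subst-rename ρ σ t)

  rename-subst : (σ : Sub {Σ = Σ} Γ Δ) (ρ : Ren {Σ = Σ} Δ Θ) (t : Tm Σ Γ A) →
                 rename ρ (subst σ t) ≡ subst (λ x → rename ρ (σ x)) t
  rename-subst σ ρ (var x)    = refl
  rename-subst σ ρ (cst c)    = refl
  rename-subst σ ρ (lam t)    = cong lam (trans (rename-subst (liftS σ) (liftR ρ) t)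
                                                (subst-cong (λ { vz → refl ; (vs x) → rename-wk ρ (σ x) }) t))
  rename-subst σ ρ (app t u)  = cong₂ app (rename-subst σ ρ t) (rename-subst σ ρ u)
  rename-subst σ ρ unit       = refl
  rename-subst σ ρ (pair t u) = cong₂ pair (rename-subst σ ρ t) (rename-subst σ ρ u)
  rename-subst σ ρ (fst t)    = cong fst (rename-subst σ ρ t)
  rename-subst σ ρ (snd t)    = cong snd (rename-subst σ ρ t)

  subst-wk : (σ : Sub {Σ = Σ} Γ Δ) (t : Tm Σ Γ A) →
             subst (liftS {B = B} σ) (wk t) ≡ wk (subst σ t)
  subst-wk σ t = trans (subst-rename vs (liftS σ) t) (sym (rename-subst σ vs t))

  subst-subst : (σ : Sub {Σ = Σ} Γ Δ) (σ' : Sub {Σ = Σ} Δ Θ) (t : Tm Σ Γ A) →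
                subst σ' (subst σ t) ≡ subst (λ x → subst σ' (σ x)) t
  subst-subst σ σ' (var x)    = refl
  subst-subst σ σ' (cst c)    = refl
  subst-subst σ σ' (lam t)    = cong lam (trans (subst-subst (liftS σ) (liftS σ') t)
                                                (subst-cong (λ { vz → refl ; (vs x) → subst-wk σ' (σ x) }) t))
  subst-subst σ σ' (app t u)  = cong₂ app (subst-subst σ σ' t) (subst-subst σ σ' u)
  subst-subst σ σ' unit       = refl
  subst-subst σ σ' (pair t u) = cong₂ pair (subst-subst σ σ' t) (subst-subst σ σ' u)
  subst-subst σ σ' (fst t)    = cong fst (subst-subst σ σ' t)
  subst-subst σ σ' (snd t)    = cong snd (subst-subst σ σ' t)

  rename-is-subst : (ρ : Ren {Σ = Σ} Γ Δ) (t : Tm Σ Γ A) → rename ρ t ≡ subst (λ x → var (ρ x)) t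
  rename-is-subst ρ (var x)    = refl
  rename-is-subst ρ (cst c)    = refl
  rename-is-subst ρ (lam t)    = cong lam (trans (rename-is-subst (liftR ρ) t)
                                                 (subst-cong (λ { vz → refl ; (vs x) → refl }) t))
  rename-is-subst ρ (app t u)  = cong₂ app (rename-is-subst ρ t) (rename-is-subst ρ u)
  rename-is-subst ρ unit       = refl
  rename-is-subst ρ (pair t u) = cong₂ pair (rename-is-subst ρ t) (rename-is-subst ρ u)
  rename-is-subst ρ (fst t)    = cong fst (rename-is-subst ρ t)
  rename-is-subst ρ (snd t)    = cong snd (rename-is-subst ρ t)

  subst-id : {σ : Sub {Σ = Σ} Γ Γ} → (∀ {A} (x : Var Γ A) → σ x ≡ var x) →
             (t : Tm Σ Γ A) → subst σ t ≡ t
  subst-id h (var x)    = h x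
  subst-id h (cst c)    = refl
  subst-id h (lam t)    = cong lam (subst-id (λ { vz → refl ; (vs x) → cong wk (h x) }) t)
  subst-id h (app t u)  = cong₂ app (subst-id h t) (subst-id h u)
  subst-id h unit       = refl
  subst-id h (pair t u) = cong₂ pair (subst-id h t) (subst-id h u)
  subst-id h (fst t)    = cong fst (subst-id h t)
  subst-id h (snd t)    = cong snd (subst-id h t)

  wk-[]₀ : (t : Tm Σ Γ A) (u : Tm Σ Γ B) → wk t [ u ]₀ ≡ t
  wk-[]₀ t u = trans (subst-rename vs (sub0 u) t) (subst-id (λ x → refl) t)

  subst-[]₀ : (σ : Sub {Σ = Σ} Γ Δ) (t : Tm Σ (Γ ▸ A) B) (u : Tm Σ Γ A) →
              subst σ (t [ u ]₀) ≡ subst (liftS σ) t [ subst σ u ]₀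
  subst-[]₀ σ t u = trans (subst-subst (sub0 u) σ t)
    (trans (subst-cong (λ { vz → refl ; (vs x) → sym (wk-[]₀ (σ x) (subst σ u)) }) t)
           (sym (subst-subst (liftS σ) (sub0 (subst σ u)) t)))

  ≡⇒≈ : {t u : Tm Σ Γ A} → t ≡ u → t ≈ u
  ≡⇒≈ refl = ≈refl

  subst-resp-≈ : (σ : Sub {Σ = Σ} Γ Δ) {t u : Tm Σ Γ A} → t ≈ u → subst σ t ≈ subst σ u
  subst-resp-≈ σ ≈refl           = ≈refl
  subst-resp-≈ σ (≈sym p)        = ≈sym (subst-resp-≈ σ p)
  subst-resp-≈ σ (≈trans p q)    = ≈trans (subst-resp-≈ σ p) (subst-resp-≈ σ q)
  subst-resp-≈ σ (lam-cong p)    = lam-cong (subst-resp-≈ (liftS σ) p)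
  subst-resp-≈ σ (app-cong p q)  = app-cong (subst-resp-≈ σ p) (subst-resp-≈ σ q)
  subst-resp-≈ σ (pair-cong p q) = pair-cong (subst-resp-≈ σ p) (subst-resp-≈ σ q)
  subst-resp-≈ σ (fst-cong p)    = fst-cong (subst-resp-≈ σ p)
  subst-resp-≈ σ (snd-cong p)    = snd-cong (subst-resp-≈ σ p)
  subst-resp-≈ σ (⇒β t u)        = ≈trans (⇒β _ _) (≡⇒≈ (sym (subst-[]₀ σ t u)))
  subst-resp-≈ σ (⇒η t)          = ≈trans (⇒η _) (lam-cong (app-cong (≡⇒≈ (sym (subst-wk σ t))) ≈refl))
  subst-resp-≈ σ (⊗β₁ t u)       = ⊗β₁ _ _
  subst-resp-≈ σ (⊗β₂ t u)       = ⊗β₂ _ _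
  subst-resp-≈ σ (⊗η t)          = ⊗η _
  subst-resp-≈ σ (𝟙η t)          = 𝟙η _

  rename-resp-≈ : (ρ : Ren {Σ = Σ} Γ Δ) {t u : Tm Σ Γ A} → t ≈ u → rename ρ t ≈ rename ρ u
  rename-resp-≈ ρ {t} {u} p =
    ≈trans (≡⇒≈ (rename-is-subst ρ t))
           (≈trans (subst-resp-≈ (λ x → var (ρ x)) p) (≡⇒≈ (sym (rename-is-subst ρ u))))

  subst-cong-≈ : {σ σ' : Sub {Σ = Σ} Γ Δ} → (∀ {A} (x : Var Γ A) → σ x ≈ σ' x) →
                 (t : Tm Σ Γ A) → subst σ t ≈ subst σ' t
  subst-cong-≈ h (var x)    = h x
  subst-cong-≈ h (cst c)    = ≈refl
  subst-cong-≈ h (lam t)    = lam-cong (subst-cong-≈ (λ { vz → ≈refl ; (vs x) → rename-resp-≈ vs (h x) }) t)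
  subst-cong-≈ h (app t u)  = app-cong (subst-cong-≈ h t) (subst-cong-≈ h u)
  subst-cong-≈ h unit       = ≈refl
  subst-cong-≈ h (pair t u) = pair-cong (subst-cong-≈ h t) (subst-cong-≈ h u)
  subst-cong-≈ h (fst t)    = fst-cong (subst-cong-≈ h t)
  subst-cong-≈ h (snd t)    = snd-cong (subst-cong-≈ h t)

module _ {Λ : Set} {Σ Σ' : Signature Λ} (F : (c : Sym Σ) → Tm Σ' (ε ▸ dom Σ c) (cod Σ c)) where
  open CCCOps (Cl Σ')
  open Interp (Cl Σ') F

  private
    variable
      Γ : Ctx Λ
      X A B : Ty Λ

  λF : (c : Sym Σ) → Tm Σ' ε (dom Σ c ⇒ cod Σ c)
  λF c = lam (F c)

  curryₕ-resp-≈ : {h h' : Hom (X ⊗ A) B} → h ≈ h' → curryₕ h ≈ curryₕ h'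
  curryₕ-resp-≈ p = lam-cong (subst-resp-≈ _ p)

  curryₕ-extEnv : (ρ : Env X Γ) (t : Tm Σ' (Γ ▸ A) B) →
                  curryₕ (subst (extEnv ρ) t) ≈ lam (subst (liftS ρ) t)
  curryₕ-extEnv ρ t =
    lam-cong (≈trans (≡⇒≈ (subst-subst (extEnv ρ) _ t)) (subst-cong-≈ unpair t))
    where
    -- the hidden substitution is the one in curryₕ, sending the variable of X ⊗ A to a pair
    unpair : ∀ {C} (x : Var (_ ▸ _) C) → subst _ (extEnv ρ x) ≈ liftS ρ x
    unpair vz     = ⊗β₂ _ _
    unpair (vs x) = ≈trans (≡⇒≈ (subst-subst _ _ (ρ x)))
                      (≈trans (subst-cong-≈ (λ { vz → ⊗β₁ _ _ ; (vs ()) }) (ρ x))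
                              (≡⇒≈ (sym (rename-is-subst vs (ρ x)))))

  ⟦⟧≈subst-csubst : (t : Tm Σ Γ A) (ρ : Env X Γ) → ⟦ t ⟧ ρ ≈ subst ρ (csubst λF t)
  ⟦⟧≈subst-csubst (var x)    ρ = ≈refl
  ⟦⟧≈subst-csubst (cst c)    ρ =
    ≈trans (≡⇒≈ (cong curryₕ F∘π₂-via-extEnv)) (curryₕ-extEnv ρ (rename (liftR (λ ())) (F c)))
    where
    F∘π₂-via-extEnv : F c ∘ₕ π₂ₕ ≡ subst (extEnv ρ) (rename (liftR (λ ())) (F c))
    F∘π₂-via-extEnv = sym (trans (subst-rename _ (extEnv ρ) (F c))
                                 (subst-cong (λ { vz → refl ; (vs ()) }) (F c)))
  ⟦⟧≈subst-csubst (lam t)    ρ =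
    ≈trans (curryₕ-resp-≈ (⟦⟧≈subst-csubst t (extEnv ρ))) (curryₕ-extEnv ρ (csubst λF t))
  ⟦⟧≈subst-csubst (app t u)  ρ = app-cong (≈trans (⊗β₁ _ _) (⟦⟧≈subst-csubst t ρ))
                                          (≈trans (⊗β₂ _ _) (⟦⟧≈subst-csubst u ρ))
  ⟦⟧≈subst-csubst unit       ρ = ≈refl
  ⟦⟧≈subst-csubst (pair t u) ρ = pair-cong (⟦⟧≈subst-csubst t ρ) (⟦⟧≈subst-csubst u ρ)
  ⟦⟧≈subst-csubst (fst t)    ρ = fst-cong (⟦⟧≈subst-csubst t ρ)
  ⟦⟧≈subst-csubst (snd t)    ρ = snd-cong (⟦⟧≈subst-csubst t ρ)

  functor≈csubst : (t : Tm Σ (ε ▸ A) B) → functor t ≈ csubst λF t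
  functor≈csubst t =
    ≈trans (⟦⟧≈subst-csubst t _) (≡⇒≈ (subst-id (λ { vz → refl ; (vs ()) }) _))

mainTheorem4 : {Λ : Set} (n : ℕ) (Ts : Fin n → Ty Λ) (bs : Fin n → Λ)
    (T : Ty Λ) (T' : Λ) (t : Tm (Boxes n Ts bs) (ε ▸ T) (base T'))
    (Σ' : Signature Λ) (ts : (i : Fin n) → Tm Σ' (ε ▸ Ts i) (base (bs i))) →
    (op t · ts) ≈ csubst (λ i → lam (ts i)) t
mainTheorem4 n Ts bs T T' t Σ' ts = functor≈csubst ts t
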